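{- Let $\Pi$ be a range with $n\ge3$ nodes $p_1,\dots,p_n$ and summit $p_s$. Then the range graph $\mathcal{RG}(\Pi)$ has at most $(n-1)^2/4+1$ vertices. Equivalently, the number of pairs $(i,j)$ with either $1<i<s\le j<n$ or $1\le j<s<i<n$ such that the horizontal line through $p_i$ meets the segment $L_j$, plus 2, is at most $(n-1)^2/4+1$.
   Context: A range is given by points $p_i=(x_i,y_i)\in\mathbb R^2$, $i\in[n]$, with $y_1=y_n$ and $y_i\ge y_1$ for all $i$. It is assumed that $y_i\neq y_j$ for $i\neq j$ unless $\{i,j\}=\{1,n\}$. The slopes are the segments $L_i=[p_i,p_{i+1}]$, $i\in[n-1]$, and the range is their union; the $p_i$ are its nodes. The summit $p_s$ is the node of maximum height $y$. For $1<i<n$ and a slope $L_j$, the intersection $p_iL_j$ is the point of $L_j$ at height $y_i$, if one exists (necessarily interior to $L_j$). The range graph $\mathcal{RG}(\Pi)$ has one vertex for each existing intersection $p_iL_j$ with $1<i<s\le j<n$ or $1\le j<s<i<n$. It has two further vertices, $p_1p_n$ and $p_sp_s$.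
   Formalization: The nodes $p_i$ of the range have rational coordinates rather than real ones. -}

module Defs where

open import Data.Nat using (ℕ; zero; suc; _+_; _*_; _∸_; _^_; _≤_; _<_)
import Data.Nat as ℕ
open import Data.Rational using (ℚ)
import Data.Rational as ℚ
import Data.Rational.Properties as ℚP
open import Data.Product using (_×_; _,_; proj₁; proj₂)
open import Data.Sum using (_⊎_)
open import Data.List using (List; []; _∷_; length; filter; concatMap; map; upTo)
open import Relation.Binary.PropositionalEquality using (_≡_)
open import Relation.Nullary using (¬_; Dec)
open import Relation.Nullary.Decidable using (_×-dec_; _⊎-dec_)
open import Relation.Unary using (Decidable)

-- A configuration of points p_i = (x_i , y_i), indexed 1-based by ℕ;
-- only the values at i ∈ [1, n] are relevant.
Points : Set
Points = ℕ → ℚ × ℚ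

height : Points → ℕ → ℚ
height p i = proj₂ (p i)

record IsRange (n : ℕ) (p : Points) : Set where
  field
    ends-equal  : height p 1 ≡ height p n
    above-start : ∀ i → 1 ≤ i → i ≤ n → height p 1 ℚ.≤ height p i
    distinct    : ∀ i j → 1 ≤ i → i ≤ n → 1 ≤ j → j ≤ n → ¬ i ≡ j →
                  ¬ (i ≡ 1 × j ≡ n) → ¬ (i ≡ n × j ≡ 1) →
                  ¬ height p i ≡ height p j

IsSummit : ℕ → Points → ℕ → Set
IsSummit n p s = (1 ≤ s × s ≤ n) × (∀ i → 1 ≤ i → i ≤ n → height p i ℚ.≤ height p s)

-- The horizontal line through p_i meets the slope L_j = [p_j , p_{j+1}],
-- i.e. the intersection p_i L_j exists.
Meets : Points → ℕ → ℕ → Set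
Meets p i j =
  (height p j ℚ.≤ height p i × height p i ℚ.≤ height p (suc j)) ⊎
  (height p (suc j) ℚ.≤ height p i × height p i ℚ.≤ height p j)

meets? : (p : Points) (i j : ℕ) → Dec (Meets p i j)
meets? p i j =
  ((height p j ℚP.≤? height p i) ×-dec (height p i ℚP.≤? height p (suc j))) ⊎-dec
  ((height p (suc j) ℚP.≤? height p i) ×-dec (height p i ℚP.≤? height p j))

IndexOK : ℕ → ℕ → ℕ × ℕ → Set
IndexOK n s (i , j) =
  (1 < i × i < s × s ≤ j × j < n) ⊎ (1 ≤ j × j < s × s < i × i < n)

indexOK? : (n s : ℕ) → Decidable (IndexOK n s)
indexOK? n s (i , j) =
  ((1 ℕ.<? i) ×-dec (i ℕ.<? s) ×-dec (s ℕ.≤? j) ×-dec (j ℕ.<? n)) ⊎-dec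
  ((1 ℕ.≤? j) ×-dec (j ℕ.<? s) ×-dec (s ℕ.<? i) ×-dec (i ℕ.<? n))

IsIntersectionVertex : ℕ → Points → ℕ → ℕ × ℕ → Set
IsIntersectionVertex n p s ij = IndexOK n s ij × Meets p (proj₁ ij) (proj₂ ij)

isIntersectionVertex? : (n : ℕ) (p : Points) (s : ℕ) → Decidable (IsIntersectionVertex n p s)
isIntersectionVertex? n p s (i , j) = indexOK? n s (i , j) ×-dec meets? p i j

allPairs : ℕ → List (ℕ × ℕ)
allPairs n = concatMap (λ i → map (λ j → (suc i , suc j)) (upTo n)) (upTo n)

-- number of vertices of the range graph RG(Π): intersections plus p_1p_n and p_sp_s
rangeGraphVertexCount : ℕ → Points → ℕ → ℕ
rangeGraphVertexCount n p s =
  length (filter (isIntersectionVertex? n p s) (allPairs n)) + 2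

{-# OPTIONS --safe #-}
module Submission where

-- Pair every slope L_u left of the summit (1 ≤ u < s) with every slope L_v right of it
-- (s ≤ v < n); this gives (s − 1)(n − s) cells. A vertex p_i L_j is seen by exactly two cells:
-- the ones pairing L_j with the two slopes that meet at p_i. Inside one cell at most two of the
-- four possible incidences (an endpoint of one slope at the height of the other slope) occur,
-- since three of them would force two distinct nodes to have the same height. In the corner
-- cells (L_1 , L_{n−1}) and (L_{s−1} , L_s) at most one occurs (none if they coincide), the
-- first because y_1 = y_n. Double counting gives 2 (|RG| − 2) ≤ 2 (s − 1)(n − s) − 2, and
-- 4 (s − 1)(n − s) ≤ (n − 1)².

open import Defs
open import Data.Nat using (ℕ; zero; suc; _+_; _*_; _∸_; _^_; _≤_; _<_; _≟_; _≤?_; z≤n; s≤s)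
open import Data.Nat.Properties
open import Data.Nat.Tactic.RingSolver using (solve-∀)
open import Algebra.Properties.CommutativeSemigroup +-commutativeSemigroup using (interchange)
open import Data.List using (List; []; _∷_; length; filter; concat; map; upTo; applyUpTo)
open import Data.List.Properties using (length-++; filter-++; filter-none; map-upTo)
open import Data.Product using (_×_; _,_; proj₁; proj₂; ∃₂)
open import Data.Rational using (ℚ)
import Data.Rational as ℚ
import Data.Rational.Properties as ℚₚ
open import Data.Sum using (_⊎_; inj₁; inj₂)
open import Function using (_∘_)
open import Relation.Binary.Bundles using (Poset)
open import Relation.Binary.PropositionalEquality
open import Relation.Nullary using (¬_; Dec; yes; no; contradiction)
open import Relation.Nullary.Decidable using (_×-dec_)
open import Relation.Unary using (Pred; Decidable)
import Data.List.Relation.Unary.All as All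

𝟙 : ∀ {a} {A : Set a} → Dec A → ℕ
𝟙 (yes _) = 1
𝟙 (no _)  = 0

𝟙-yes : ∀ {a} {A : Set a} → A → (d : Dec A) → 𝟙 d ≡ 1
𝟙-yes _ (yes _) = refl
𝟙-yes x (no ¬x) = contradiction x ¬x

𝟙-no : ∀ {a} {A : Set a} → ¬ A → (d : Dec A) → 𝟙 d ≡ 0
𝟙-no ¬x (yes x) = contradiction x ¬x
𝟙-no _  (no _)  = refl

𝟙≤1 : ∀ {a} {A : Set a} (d : Dec A) → 𝟙 d ≤ 1
𝟙≤1 (yes _) = ≤-refl
𝟙≤1 (no _)  = z≤n

𝟙-exclusive : ∀ {a b} {A : Set a} {B : Set b} → ¬ (A × B) → (d : Dec A) (e : Dec B) → 𝟙 d + 𝟙 e ≤ 1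
𝟙-exclusive ¬ab (yes a) e = ≤-reflexive (cong suc (𝟙-no (λ b → ¬ab (a , b)) e))
𝟙-exclusive _   (no _)  e = 𝟙≤1 e

𝟙-at-most-two : ∀ {a} {A₁ A₂ A₃ A₄ : Set a} (d₁ : Dec A₁) (d₂ : Dec A₂) (d₃ : Dec A₃) (d₄ : Dec A₄) →
                ¬ (A₁ × A₂ × A₃) → ¬ (A₁ × A₂ × A₄) → ¬ (A₁ × A₃ × A₄) → ¬ (A₂ × A₃ × A₄) →
                𝟙 d₁ + 𝟙 d₂ + 𝟙 d₃ + 𝟙 d₄ ≤ 2
𝟙-at-most-two (yes a₁) (yes a₂) d₃ d₄ ¬₁₂₃ ¬₁₂₄ _ _
  rewrite 𝟙-no (λ a₃ → ¬₁₂₃ (a₁ , a₂ , a₃)) d₃ | 𝟙-no (λ a₄ → ¬₁₂₄ (a₁ , a₂ , a₄)) d₄ = ≤-refl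
𝟙-at-most-two (yes a₁) (no _)   d₃ d₄ _ _ ¬₁₃₄ _ = s≤s (𝟙-exclusive (λ (a₃ , a₄) → ¬₁₃₄ (a₁ , a₃ , a₄)) d₃ d₄)
𝟙-at-most-two (no _)   (yes a₂) d₃ d₄ _ _ _ ¬₂₃₄ = s≤s (𝟙-exclusive (λ (a₃ , a₄) → ¬₂₃₄ (a₂ , a₃ , a₄)) d₃ d₄)
𝟙-at-most-two (no _)   (no _)   d₃ d₄ _ _ _ _    = +-mono-≤ (𝟙≤1 d₃) (𝟙≤1 d₄)

+[𝟙+𝟙]≤2 : ∀ {a} {C₁ C₂ : Set a} {g : ℕ} (c₁ : Dec C₁) (c₂ : Dec C₂) →
            g ≤ 2 → (C₁ → g ≤ 1) → (C₂ → g ≤ 1) → (C₁ → C₂ → g ≡ 0) → g + (𝟙 c₁ + 𝟙 c₂) ≤ 2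
+[𝟙+𝟙]≤2 (yes x₁) (yes x₂) _ _ _ g≡0 rewrite g≡0 x₁ x₂ = ≤-refl
+[𝟙+𝟙]≤2 (yes x₁) (no _)   _ g≤1 _ _ = +-monoˡ-≤ 1 (g≤1 x₁)
+[𝟙+𝟙]≤2 (no _)   (yes x₂) _ _ g≤1 _ = +-monoˡ-≤ 1 (g≤1 x₂)
+[𝟙+𝟙]≤2 {g = g} (no _) (no _) g≤2 _ _ _ rewrite +-identityʳ g = g≤2

-- Sums over intervals

-- ∑ a k f = f a + f (a + 1) + ⋯ + f (a + k − 1)
∑ : ℕ → ℕ → (ℕ → ℕ) → ℕ
∑ a zero    f = 0
∑ a (suc k) f = ∑ a k f + f (a + k)

private
  widen : ∀ a k {t} → t < a + k → t < a + suc k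
  widen a k t<a+k = <-≤-trans t<a+k (+-monoʳ-≤ a (n≤1+n k))

  last<a+suc : ∀ a k → a + k < a + suc k
  last<a+suc a k = +-monoʳ-< a (n<1+n k)

∑-cong : ∀ a k {f g} → (∀ {t} → a ≤ t → t < a + k → f t ≡ g t) → ∑ a k f ≡ ∑ a k g
∑-cong a zero    eq = refl
∑-cong a (suc k) eq =
  cong₂ _+_ (∑-cong a k (λ a≤t t<a+k → eq a≤t (widen a k t<a+k))) (eq (m≤m+n a k) (last<a+suc a k))

∑-mono-≤ : ∀ a k {f g} → (∀ {t} → a ≤ t → t < a + k → f t ≤ g t) → ∑ a k f ≤ ∑ a k g
∑-mono-≤ a zero    le = z≤n
∑-mono-≤ a (suc k) le =
  +-mono-≤ (∑-mono-≤ a k (λ a≤t t<a+k → le a≤t (widen a k t<a+k))) (le (m≤m+n a k) (last<a+suc a k))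

∑-const : ∀ a k c → ∑ a k (λ _ → c) ≡ k * c
∑-const a zero    c = refl
∑-const a (suc k) c = trans (cong (_+ c) (∑-const a k c)) (+-comm (k * c) c)

∑-zero : ∀ a k {f} → (∀ {t} → a ≤ t → t < a + k → f t ≡ 0) → ∑ a k f ≡ 0
∑-zero a k eq = trans (∑-cong a k eq) (trans (∑-const a k 0) (*-zeroʳ k))

∑-+ : ∀ a k (f g : ℕ → ℕ) → ∑ a k (λ t → f t + g t) ≡ ∑ a k f + ∑ a k g
∑-+ a zero    f g = refl
∑-+ a (suc k) f g = trans (cong (_+ (f (a + k) + g (a + k))) (∑-+ a k f g))
                          (interchange (∑ a k f) (∑ a k g) (f (a + k)) (g (a + k)))

∑-swap : ∀ a k b m (f : ℕ → ℕ → ℕ) →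
         ∑ a k (λ i → ∑ b m (f i)) ≡ ∑ b m (λ j → ∑ a k (λ i → f i j))
∑-swap a zero    b m f = sym (∑-zero b m (λ _ _ → refl))
∑-swap a (suc k) b m f = trans (cong (_+ ∑ b m (f (a + k))) (∑-swap a k b m f))
                               (sym (∑-+ b m (λ j → ∑ a k (λ i → f i j)) (f (a + k))))

∑-suc : ∀ a k f → ∑ a k (f ∘ suc) ≡ ∑ (suc a) k f
∑-suc a zero    f = refl
∑-suc a (suc k) f = cong (_+ f (suc (a + k))) (∑-suc a k f)

∑-cons : ∀ a k f → ∑ a (suc k) f ≡ f a + ∑ (suc a) k f
∑-cons a zero    f = trans (cong f (+-identityʳ a)) (sym (+-identityʳ (f a)))
∑-cons a (suc k) f = begin
  ∑ a (suc k) f + f (a + suc k)        ≡⟨ cong₂ _+_ (∑-cons a k f) (cong f (+-suc a k)) ⟩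
  f a + ∑ (suc a) k f + f (suc a + k)  ≡⟨ +-assoc (f a) _ _ ⟩
  f a + ∑ (suc a) (suc k) f            ∎
  where open ≡-Reasoning

∑-shift : ∀ a k {f} → f a ≡ 0 → f (a + k) ≡ 0 → ∑ a k (f ∘ suc) ≡ ∑ a k f
∑-shift a k {f} fa≡0 fa+k≡0 = begin
  ∑ a k (f ∘ suc)          ≡⟨ ∑-suc a k f ⟩
  ∑ (suc a) k f            ≡⟨ cong (_+ ∑ (suc a) k f) fa≡0 ⟨
  f a + ∑ (suc a) k f      ≡⟨ ∑-cons a k f ⟨
  ∑ a k f + f (a + k)      ≡⟨ cong (∑ a k f +_) fa+k≡0 ⟩
  ∑ a k f + 0              ≡⟨ +-identityʳ _ ⟩
  ∑ a k f                  ∎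
  where open ≡-Reasoning

∑-split : ∀ a k m f → ∑ a (k + m) f ≡ ∑ a k f + ∑ (a + k) m f
∑-split a k zero    f = trans (cong (λ k′ → ∑ a k′ f) (+-identityʳ k)) (sym (+-identityʳ _))
∑-split a k (suc m) f = begin
  ∑ a (k + suc m) f                          ≡⟨ cong (λ k′ → ∑ a k′ f) (+-suc k m) ⟩
  ∑ a (k + m) f + f (a + (k + m))            ≡⟨ cong₂ _+_ (∑-split a k m f) (cong f (sym (+-assoc a k m))) ⟩
  ∑ a k f + ∑ (a + k) m f + f (a + k + m)    ≡⟨ +-assoc (∑ a k f) _ _ ⟩
  ∑ a k f + ∑ (a + k) (suc m) f              ∎
  where open ≡-Reasoning

∑-single : ∀ a k {f} c → a ≤ c → c < a + k → (∀ {t} → t ≢ c → f t ≡ 0) → ∑ a k f ≡ f c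
∑-single a zero    c a≤c c<a+0 _ = contradiction (subst (c <_) (+-identityʳ a) c<a+0) (≤⇒≯ a≤c)
∑-single a (suc k) {f} c a≤c c<a+suc vanish with m≤n⇒m<n∨m≡n (≤-pred (subst (c <_) (+-suc a k) c<a+suc))
... | inj₁ c<a+k = begin
  ∑ a k f + f (a + k)  ≡⟨ cong₂ _+_ (∑-single a k c a≤c c<a+k vanish) (vanish (>⇒≢ c<a+k)) ⟩
  f c + 0              ≡⟨ +-identityʳ _ ⟩
  f c                  ∎
  where open ≡-Reasoning
... | inj₂ refl = cong (_+ f (a + k)) (∑-zero a k (λ _ t<a+k → vanish (<⇒≢ t<a+k)))

∑∑-δ : ∀ a k b m {c d} → a ≤ c → c < a + k → b ≤ d → d < b + m →
       ∑ a k (λ i → ∑ b m (λ j → 𝟙 ((i ≟ c) ×-dec (j ≟ d)))) ≡ 1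
∑∑-δ a k b m {c} {d} a≤c c<a+k b≤d d<b+m = begin
  ∑ a k (λ i → ∑ b m (λ j → 𝟙 ((i ≟ c) ×-dec (j ≟ d))))
    ≡⟨ ∑-cong a k (λ {i} _ _ → ∑-single b m d b≤d d<b+m (λ {j} j≢d → 𝟙-no (j≢d ∘ proj₂) ((i ≟ c) ×-dec (j ≟ d)))) ⟩
  ∑ a k (λ i → 𝟙 ((i ≟ c) ×-dec (d ≟ d)))
    ≡⟨ ∑-single a k c a≤c c<a+k (λ {i} i≢c → 𝟙-no (i≢c ∘ proj₁) ((i ≟ c) ×-dec (d ≟ d))) ⟩
  𝟙 ((c ≟ c) ×-dec (d ≟ d))
    ≡⟨ 𝟙-yes (refl , refl) ((c ≟ c) ×-dec (d ≟ d)) ⟩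
  1 ∎
  where open ≡-Reasoning

∑-applyUpTo : ∀ {a} {A : Set a} (F : List A → ℕ) (h : A → ℕ) →
              F [] ≡ 0 → (∀ x xs → F (x ∷ xs) ≡ h x + F xs) →
              ∀ f k → F (applyUpTo f k) ≡ ∑ 0 k (h ∘ f)
∑-applyUpTo F h F[] F∷ f zero    = F[]
∑-applyUpTo F h F[] F∷ f (suc k) = begin
  F (f 0 ∷ applyUpTo (f ∘ suc) k)       ≡⟨ F∷ (f 0) _ ⟩
  h (f 0) + F (applyUpTo (f ∘ suc) k)   ≡⟨ cong (h (f 0) +_) (∑-applyUpTo F h F[] F∷ (f ∘ suc) k) ⟩
  h (f 0) + ∑ 0 k (h ∘ f ∘ suc)         ≡⟨ cong (h (f 0) +_) (∑-suc 0 k (h ∘ f)) ⟩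
  h (f 0) + ∑ 1 k (h ∘ f)               ≡⟨ ∑-cons 0 k (h ∘ f) ⟨
  ∑ 0 (suc k) (h ∘ f)                   ∎
  where open ≡-Reasoning

module _ {a p} {A : Set a} {P : Pred A p} (P? : Decidable P) where

  length-filter-∷ : ∀ x xs → length (filter P? (x ∷ xs)) ≡ 𝟙 (P? x) + length (filter P? xs)
  length-filter-∷ x xs with P? x
  ... | yes _ = refl
  ... | no _  = refl

  length-filter-concat-∷ : ∀ xs xss → length (filter P? (concat (xs ∷ xss))) ≡
                           length (filter P? xs) + length (filter P? (concat xss))
  length-filter-concat-∷ xs xss =
    trans (cong length (filter-++ P? xs (concat xss))) (length-++ (filter P? xs))

length-filter-allPairs : ∀ {p} {P : Pred (ℕ × ℕ) p} (P? : Decidable P) n →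
                         length (filter P? (allPairs n)) ≡ ∑ 1 n (λ i → ∑ 1 n (λ j → 𝟙 (P? (i , j))))
length-filter-allPairs P? n = begin
  length (filter P? (concat (map row (upTo n))))      ≡⟨ cong (length ∘ filter P? ∘ concat) (map-upTo row n) ⟩
  length (filter P? (concat (applyUpTo row n)))       ≡⟨ ∑-applyUpTo (length ∘ filter P? ∘ concat) (length ∘ filter P?)
                                                           refl (length-filter-concat-∷ P?) row n ⟩
  ∑ 0 n (λ i → length (filter P? (row i)))            ≡⟨ ∑-cong 0 n (λ {i} _ _ → length-filter-row i) ⟩
  ∑ 0 n (λ i → ∑ 1 n (λ j → 𝟙 (P? (suc i , j))))      ≡⟨ ∑-suc 0 n (λ i → ∑ 1 n (λ j → 𝟙 (P? (i , j)))) ⟩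
  ∑ 1 n (λ i → ∑ 1 n (λ j → 𝟙 (P? (i , j))))          ∎
  where
    open ≡-Reasoning
    row : ℕ → List (ℕ × ℕ)
    row i = map (λ j → (suc i , suc j)) (upTo n)
    length-filter-row : ∀ i → length (filter P? (row i)) ≡ ∑ 1 n (λ j → 𝟙 (P? (suc i , j)))
    length-filter-row i = begin
      length (filter P? (row i))                               ≡⟨ cong (length ∘ filter P?) (map-upTo _ n) ⟩
      length (filter P? (applyUpTo (λ j → (suc i , suc j)) n)) ≡⟨ ∑-applyUpTo (length ∘ filter P?) (𝟙 ∘ P?)
                                                                    refl (length-filter-∷ P?) _ n ⟩
      ∑ 0 n (λ j → 𝟙 (P? (suc i , suc j)))                     ≡⟨ ∑-suc 0 n (λ j → 𝟙 (P? (suc i , j))) ⟩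
      ∑ 1 n (λ j → 𝟙 (P? (suc i , j)))                         ∎

-- Betweenness in a poset

module Betweenness {c ℓ₁ ℓ₂} (P : Poset c ℓ₁ ℓ₂) where
  open Poset P using (Carrier; _≈_) renaming (_≤_ to _≼_; trans to ≼-trans; antisym to ≼-antisym)

  Between : Carrier → Carrier → Carrier → Set ℓ₂
  Between a b x = (a ≼ x × x ≼ b) ⊎ (b ≼ x × x ≼ a)

  Between-sym : ∀ {a b x} → Between a b x → Between b a x
  Between-sym (inj₁ q) = inj₂ q
  Between-sym (inj₂ q) = inj₁ q

  Between-sandwich : ∀ {b b′ x z} → Between b b′ x → Between b b′ z → Between x z b → b ≈ x ⊎ b ≈ z
  Between-sandwich (inj₁ (b≼x , _))  (inj₁ (b≼z , _))  (inj₁ (x≼b , _)) = inj₁ (≼-antisym b≼x x≼b)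
  Between-sandwich (inj₁ (b≼x , _))  (inj₁ (b≼z , _))  (inj₂ (z≼b , _)) = inj₂ (≼-antisym b≼z z≼b)
  Between-sandwich (inj₁ (b≼x , x≼b′)) (inj₂ (b′≼z , z≼b)) _ = inj₁ (≼-antisym b≼x (≼-trans x≼b′ (≼-trans b′≼z z≼b)))
  Between-sandwich (inj₂ (b′≼x , x≼b)) (inj₁ (b≼z , z≼b′)) _ = inj₂ (≼-antisym b≼z (≼-trans z≼b′ (≼-trans b′≼x x≼b)))
  Between-sandwich (inj₂ (_ , x≼b))  (inj₂ (_ , z≼b))  (inj₁ (_ , b≼z)) = inj₂ (≼-antisym b≼z z≼b)
  Between-sandwich (inj₂ (_ , x≼b))  (inj₂ (_ , z≼b))  (inj₂ (_ , b≼x)) = inj₁ (≼-antisym b≼x x≼b)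

  Between-mutual : ∀ {c d x} → Between c d x → Between c x d → x ≈ d
  Between-mutual (inj₁ (_ , x≼d))   (inj₁ (_ , d≼x))   = ≼-antisym x≼d d≼x
  Between-mutual (inj₁ (c≼x , x≼d)) (inj₂ (_ , d≼c))   = ≼-antisym x≼d (≼-trans d≼c c≼x)
  Between-mutual (inj₂ (d≼x , x≼c)) (inj₁ (c≼d , _))   = ≼-antisym (≼-trans x≼c c≼d) d≼x
  Between-mutual (inj₂ (d≼x , _))   (inj₂ (x≼d , _))   = ≼-antisym x≼d d≼x

ℚ-≤-poset : Poset _ _ _
ℚ-≤-poset = record { Carrier = ℚ; _≈_ = _≡_; _≤_ = ℚ._≤_; isPartialOrder = ℚₚ.≤-isPartialOrder }

private
  4[m*n]≤[m+n]^2-≤ : ∀ {m n} → m ≤ n → 4 * (m * n) ≤ (m + n) ^ 2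
  4[m*n]≤[m+n]^2-≤ {m} m≤n with m≤n⇒∃[o]m+o≡n m≤n
  ... | d , refl = subst (4 * (m * (m + d)) ≤_) (square m d) (m≤m+n _ (d * d))
    where
      -- the right-hand side is (m + (m + d)) ^ 2 unfolded, as the ring solver does not accept _^_
      square : ∀ m d → 4 * (m * (m + d)) + d * d ≡ (m + (m + d)) * ((m + (m + d)) * 1)
      square = solve-∀

4[m*n]≤[m+n]^2 : ∀ m n → 4 * (m * n) ≤ (m + n) ^ 2
4[m*n]≤[m+n]^2 m n with ≤-total m n
... | inj₁ m≤n = 4[m*n]≤[m+n]^2-≤ m≤n
... | inj₂ n≤m = subst₂ (λ x y → 4 * x ≤ y ^ 2) (*-comm n m) (+-comm n m) (4[m*n]≤[m+n]^2-≤ n≤m)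

4[m+2]≤[a+b]^2+4 : ∀ {m} a b → m + 1 ≤ a * b → 4 * (m + 2) ≤ (a + b) ^ 2 + 4
4[m+2]≤[a+b]^2+4 {m} a b m+1≤ab = begin
  4 * (m + 2)        ≡⟨ cong (4 *_) (+-assoc m 1 1) ⟨
  4 * (m + 1 + 1)    ≡⟨ *-distribˡ-+ 4 (m + 1) 1 ⟩
  4 * (m + 1) + 4    ≤⟨ +-monoˡ-≤ 4 (≤-trans (*-monoʳ-≤ 4 m+1≤ab) (4[m*n]≤[m+n]^2 a b)) ⟩
  (a + b) ^ 2 + 4    ∎
  where open ≤-Reasoning

-- The vertices of a range graph

module RangeGraphVertices (p : Points) (l r : ℕ) (1≤l : 1 ≤ l) (1≤r : 1 ≤ r) (R : IsRange (suc l + r) p) where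
  open IsRange R using (ends-equal; distinct)
  open Betweenness ℚ-≤-poset

  -- l = s − 1 slopes lie left of p_s and r = n − s slopes right of it; n′ = n − 1.
  s n′ n : ℕ
  s  = suc l
  n′ = l + r
  n  = suc n′

  s≤n′ : s ≤ n′
  s≤n′ = subst (_≤ n′) (+-comm l 1) (+-monoʳ-≤ l 1≤r)

  y : ℕ → ℚ
  y = height p

  V : ℕ → ℕ → Set
  V i j = IsIntersectionVertex n p s (i , j)

  V? : ∀ i j → Dec (V i j)
  V? i j = isIntersectionVertex? n p s (i , j)

  χ : ℕ → ℕ → ℕ
  χ i j = 𝟙 (V? i j)

  χ-zero : ∀ {i j} → ¬ V i j → χ i j ≡ 0
  χ-zero ¬v = 𝟙-no ¬v _

  meets : ∀ {i j} → V i j → Between (y j) (y (suc j)) (y i)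
  meets = proj₂

  vertex-interior : ∀ {i j} → V i j → 1 < i × i < n
  vertex-interior (inj₁ (1<i , i<s , s≤j , j<n) , _) = 1<i , <-trans i<s (≤-<-trans s≤j j<n)
  vertex-interior (inj₂ (1≤j , j<s , s<i , i<n) , _) = ≤-<-trans 1≤j (<-trans j<s s<i) , i<n

  vertex-≢-summit : ∀ {i j} → V i j → i ≢ s
  vertex-≢-summit (inj₁ (_ , i<s , _) , _)     = <⇒≢ i<s
  vertex-≢-summit (inj₂ (_ , _ , s<i , _) , _) = >⇒≢ s<i

  ¬V-first-row : ∀ {j} → ¬ V 1 j
  ¬V-first-row v = <-irrefl refl (proj₁ (vertex-interior v))

  ¬V-last-row : ∀ {j} → ¬ V n j
  ¬V-last-row v = <-irrefl refl (proj₂ (vertex-interior v))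

  ¬V-summit-row : ∀ {j} → ¬ V s j
  ¬V-summit-row v = vertex-≢-summit v refl

  ¬V-last-column : ∀ {i} → ¬ V i n
  ¬V-last-column (inj₁ (_ , _ , _ , n<n) , _)     = <-irrefl refl n<n
  ¬V-last-column (inj₂ (_ , n<s , s<i , i<n) , _) = <-asym n<s (<-trans s<i i<n)

  ¬V-below : ∀ {i j} → i < s → j < s → ¬ V i j
  ¬V-below _   j<s (inj₁ (_ , _ , s≤j , _) , _) = <⇒≱ j<s s≤j
  ¬V-below i<s _   (inj₂ (_ , _ , s<i , _) , _) = <-asym i<s s<i

  ¬V-above : ∀ {i j} → s ≤ i → s ≤ j → ¬ V i j
  ¬V-above s≤i _   (inj₁ (_ , i<s , _) , _) = <⇒≱ i<s s≤i
  ¬V-above _   s≤j (inj₂ (_ , j<s , _) , _) = <⇒≱ j<s s≤j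

  vertex-heights-≢ : ∀ {i j i′ j′} → V i j → V i′ j′ → i ≢ i′ → y i ≢ y i′
  vertex-heights-≢ v v′ i≢i′ with vertex-interior v | vertex-interior v′
  ... | 1<i , i<n | 1<i′ , i′<n =
    distinct _ _ (<⇒≤ 1<i) (<⇒≤ i<n) (<⇒≤ 1<i′) (<⇒≤ i′<n) i≢i′
             (λ (i≡1 , _) → >⇒≢ 1<i i≡1) (λ (i≡n , _) → <⇒≢ i<n i≡n)

  -- The cell (u , v) pairs the slopes L_u and L_v and counts the vertices formed by an endpoint
  -- of either slope with the other one; a vertex p_i L_j is counted by the cells (i − 1 , j) and
  -- (i , j) if i < s, and by (j , i − 1) and (j , i) if s < i.
  incidences : ℕ → ℕ → ℕ
  incidences u v = χ u v + χ (suc u) v + χ v u + χ (suc v) u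

  module _ {u v : ℕ} (u<s : u < s) (s≤v : s ≤ v) where
    private
      u≢v : u ≢ v
      u≢v = <⇒≢ (<-≤-trans u<s s≤v)

      u≢1+v : u ≢ suc v
      u≢1+v = <⇒≢ (m<n⇒m<1+n (<-≤-trans u<s s≤v))

      1+u≢1+v : suc u ≢ suc v
      1+u≢1+v = u≢v ∘ suc-injective

      1+u≢v : V (suc u) v → suc u ≢ v
      1+u≢v a = <⇒≢ (<-≤-trans (≤∧≢⇒< u<s (vertex-≢-summit a)) s≤v)

      ¬₁₂₃ : ¬ (V u v × V (suc u) v × V v u)
      ¬₁₂₃ (a₁ , a₂ , a₃) with Between-sandwich (meets a₁) (meets a₂) (meets a₃)
      ... | inj₁ e = vertex-heights-≢ a₃ a₁ (≢-sym u≢v) e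
      ... | inj₂ e = vertex-heights-≢ a₃ a₂ (≢-sym (1+u≢v a₂)) e

      ¬₁₂₄ : ¬ (V u v × V (suc u) v × V (suc v) u)
      ¬₁₂₄ (a₁ , a₂ , a₄) with Between-sandwich (Between-sym (meets a₁)) (Between-sym (meets a₂)) (meets a₄)
      ... | inj₁ e = vertex-heights-≢ a₄ a₁ (≢-sym u≢1+v) e
      ... | inj₂ e = vertex-heights-≢ a₄ a₂ (≢-sym 1+u≢1+v) e

      ¬₁₃₄ : ¬ (V u v × V v u × V (suc v) u)
      ¬₁₃₄ (a₁ , a₃ , a₄) with Between-sandwich (meets a₃) (meets a₄) (meets a₁)
      ... | inj₁ e = vertex-heights-≢ a₁ a₃ u≢v e
      ... | inj₂ e = vertex-heights-≢ a₁ a₄ u≢1+v e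

      ¬₂₃₄ : ¬ (V (suc u) v × V v u × V (suc v) u)
      ¬₂₃₄ (a₂ , a₃ , a₄) with Between-sandwich (Between-sym (meets a₃)) (Between-sym (meets a₄)) (meets a₂)
      ... | inj₁ e = vertex-heights-≢ a₂ a₃ (1+u≢v a₂) e
      ... | inj₂ e = vertex-heights-≢ a₂ a₄ 1+u≢1+v e

    incidences≤2 : incidences u v ≤ 2
    incidences≤2 = 𝟙-at-most-two (V? u v) (V? (suc u) v) (V? v u) (V? (suc v) u) ¬₁₂₃ ¬₁₂₄ ¬₁₃₄ ¬₂₃₄

  corner₁-exclusive : ¬ (V 2 n′ × V n′ 1)
  corner₁-exclusive (a , b) = vertex-heights-≢ a b 2≢n′ (Between-mutual a′ (meets b))
    where
      a′ : Between (y 1) (y n′) (y 2)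
      a′ = Between-sym (subst (λ z → Between (y n′) z (y 2)) (sym ends-equal) (meets a))
      2≢n′ : 2 ≢ n′
      2≢n′ = <⇒≢ (≤-<-trans (s≤s 1≤l) (≤∧≢⇒< s≤n′ (≢-sym (vertex-≢-summit b))))

  corner₂-exclusive : ¬ (V l s × V (suc s) l)
  corner₂-exclusive (a , b) =
    vertex-heights-≢ a b (<⇒≢ (m<n⇒m<1+n (n<1+n l))) (Between-mutual (meets a) (Between-sym (meets b)))

  incidences-corner₁ : incidences 1 n′ ≤ 1
  incidences-corner₁ = begin
    incidences 1 n′        ≡⟨ cong₂ (λ x z → x + χ 2 n′ + χ n′ 1 + z)
                                    (χ-zero ¬V-first-row) (χ-zero ¬V-last-row) ⟩
    χ 2 n′ + χ n′ 1 + 0    ≡⟨ +-identityʳ _ ⟩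
    χ 2 n′ + χ n′ 1        ≤⟨ 𝟙-exclusive corner₁-exclusive (V? 2 n′) (V? n′ 1) ⟩
    1                      ∎
    where open ≤-Reasoning

  incidences-corner₂ : incidences l s ≤ 1
  incidences-corner₂ = begin
    incidences l s                ≡⟨ cong₂ (λ x z → χ l s + x + z + χ (suc s) l)
                                           (χ-zero ¬V-summit-row) (χ-zero ¬V-summit-row) ⟩
    χ l s + 0 + 0 + χ (suc s) l   ≡⟨ cong (_+ χ (suc s) l) (trans (+-identityʳ _) (+-identityʳ _)) ⟩
    χ l s + χ (suc s) l           ≤⟨ 𝟙-exclusive corner₂-exclusive (V? l s) (V? (suc s) l) ⟩
    1                             ∎
    where open ≤-Reasoning

  incidences-corners : 1 ≡ l → n′ ≡ s → incidences 1 n′ ≡ 0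
  incidences-corners 1≡l n′≡s =
    cong₂ _+_ (cong₂ _+_ (cong₂ _+_ (χ-zero ¬V-first-row)
                                    (χ-zero (subst (λ i → ¬ V i n′) (sym (cong suc 1≡l)) ¬V-summit-row)))
                         (χ-zero (subst (λ i → ¬ V i 1) (sym n′≡s) ¬V-summit-row)))
              (χ-zero ¬V-last-row)

  corner₁? : ∀ u v → Dec (u ≡ 1 × v ≡ n′)
  corner₁? u v = (u ≟ 1) ×-dec (v ≟ n′)

  corner₂? : ∀ u v → Dec (u ≡ l × v ≡ s)
  corner₂? u v = (u ≟ l) ×-dec (v ≟ s)

  incidences+corners≤2 : ∀ {u v} → u < s → s ≤ v → incidences u v + (𝟙 (corner₁? u v) + 𝟙 (corner₂? u v)) ≤ 2
  incidences+corners≤2 {u} {v} u<s s≤v = +[𝟙+𝟙]≤2 (corner₁? u v) (corner₂? u v) (incidences≤2 u<s s≤v)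
    (λ { (refl , refl) → incidences-corner₁ })
    (λ { (refl , refl) → incidences-corner₂ })
    (λ { (refl , refl) (1≡l , n′≡s) → incidences-corners 1≡l n′≡s })

  ∑cells : (ℕ → ℕ → ℕ) → ℕ
  ∑cells f = ∑ 1 l (λ u → ∑ s r (f u))

  ∑cells-+ : ∀ f g → ∑cells (λ u v → f u v + g u v) ≡ ∑cells f + ∑cells g
  ∑cells-+ f g = trans (∑-cong 1 l (λ {u} _ _ → ∑-+ s r (f u) (g u))) (∑-+ 1 l _ _)

  ∑cells-+₄ : ∀ f g h k → ∑cells (λ u v → f u v + g u v + h u v + k u v) ≡
                          ∑cells f + ∑cells g + ∑cells h + ∑cells k
  ∑cells-+₄ f g h k = begin
    ∑cells (λ u v → f u v + g u v + h u v + k u v)   ≡⟨ ∑cells-+ (λ u v → f u v + g u v + h u v) k ⟩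
    ∑cells (λ u v → f u v + g u v + h u v) + ∑cells k ≡⟨ cong (_+ ∑cells k) (∑cells-+ (λ u v → f u v + g u v) h) ⟩
    ∑cells (λ u v → f u v + g u v) + ∑cells h + ∑cells k
      ≡⟨ cong (λ x → x + ∑cells h + ∑cells k) (∑cells-+ f g) ⟩
    ∑cells f + ∑cells g + ∑cells h + ∑cells k         ∎
    where open ≡-Reasoning

  ∑cells-incidences+2≤ : ∑cells incidences + 2 ≤ 2 * (l * r)
  ∑cells-incidences+2≤ = begin
    ∑cells incidences + 2
      ≡⟨ cong (∑cells incidences +_) (trans (∑cells-+ corner₁ corner₂) (cong₂ _+_ ∑cells-corner₁ ∑cells-corner₂)) ⟨
    ∑cells incidences + ∑cells (λ u v → corner₁ u v + corner₂ u v)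
      ≡⟨ ∑cells-+ incidences (λ u v → corner₁ u v + corner₂ u v) ⟨
    ∑cells (λ u v → incidences u v + (corner₁ u v + corner₂ u v))
      ≤⟨ ∑-mono-≤ 1 l (λ _ u<s → ∑-mono-≤ s r (λ s≤v _ → incidences+corners≤2 u<s s≤v)) ⟩
    ∑cells (λ _ _ → 2)
      ≡⟨ trans (∑-cong 1 l (λ _ _ → ∑-const s r 2)) (∑-const 1 l (r * 2)) ⟩
    l * (r * 2)
      ≡⟨ trans (sym (*-assoc l r 2)) (*-comm (l * r) 2) ⟩
    2 * (l * r) ∎
    where
      open ≤-Reasoning
      corner₁ corner₂ : ℕ → ℕ → ℕ
      corner₁ u v = 𝟙 (corner₁? u v)
      corner₂ u v = 𝟙 (corner₂? u v)
      ∑cells-corner₁ : ∑cells corner₁ ≡ 1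
      ∑cells-corner₁ = ∑∑-δ 1 l s r ≤-refl (s≤s 1≤l) s≤n′ ≤-refl
      ∑cells-corner₂ : ∑cells corner₂ ≡ 1
      ∑cells-corner₂ = ∑∑-δ 1 l s r 1≤l ≤-refl ≤-refl (m<m+n s 1≤r)

  leftVertices rightVertices : ℕ
  leftVertices  = ∑ 1 l (λ i → ∑ s r (χ i))
  rightVertices = ∑ s r (λ i → ∑ 1 l (χ i))

  vertexCount : ℕ
  vertexCount = length (filter (isIntersectionVertex? n p s) (allPairs n))

  vertexCount≡left+right : vertexCount ≡ leftVertices + rightVertices
  vertexCount≡left+right = begin
    vertexCount                         ≡⟨ length-filter-allPairs (isIntersectionVertex? n p s) n ⟩
    ∑ 1 (l + r) row + row n             ≡⟨ cong (_+ row n) (∑-split 1 l r row) ⟩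
    ∑ 1 l row + ∑ s r row + row n       ≡⟨ cong₂ _+_ (cong₂ _+_ (∑-cong 1 l (λ _ i<s → left-row i<s))
                                                                (∑-cong s r (λ s≤i _ → right-row s≤i)))
                                                     (∑-zero 1 n (λ _ _ → χ-zero ¬V-last-row)) ⟩
    leftVertices + rightVertices + 0    ≡⟨ +-identityʳ _ ⟩
    leftVertices + rightVertices        ∎
    where
      open ≡-Reasoning
      row : ℕ → ℕ
      row i = ∑ 1 n (χ i)
      row-split : ∀ i → row i ≡ ∑ 1 l (χ i) + ∑ s r (χ i) + χ i n
      row-split i = cong (_+ χ i n) (∑-split 1 l r (χ i))
      left-row : ∀ {i} → i < s → row i ≡ ∑ s r (χ i)
      left-row {i} i<s = begin
        row i                                ≡⟨ row-split i ⟩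
        ∑ 1 l (χ i) + ∑ s r (χ i) + χ i n    ≡⟨ cong₂ (λ x z → x + ∑ s r (χ i) + z)
                                                      (∑-zero 1 l (λ _ j<s → χ-zero (¬V-below i<s j<s)))
                                                      (χ-zero ¬V-last-column) ⟩
        ∑ s r (χ i) + 0                      ≡⟨ +-identityʳ _ ⟩
        ∑ s r (χ i)                          ∎
      right-row : ∀ {i} → s ≤ i → row i ≡ ∑ 1 l (χ i)
      right-row {i} s≤i = begin
        row i                                ≡⟨ row-split i ⟩
        ∑ 1 l (χ i) + ∑ s r (χ i) + χ i n    ≡⟨ cong₂ (λ x z → ∑ 1 l (χ i) + x + z)
                                                      (∑-zero s r (λ s≤j _ → χ-zero (¬V-above s≤i s≤j)))
                                                      (χ-zero ¬V-last-column) ⟩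
        ∑ 1 l (χ i) + 0 + 0                  ≡⟨ trans (+-identityʳ _) (+-identityʳ _) ⟩
        ∑ 1 l (χ i)                          ∎

  ∑cells-incidences : ∑cells incidences ≡ 2 * (leftVertices + rightVertices)
  ∑cells-incidences = begin
    ∑cells incidences
      ≡⟨ ∑cells-+₄ χ (χ ∘ suc) (λ u v → χ v u) (λ u v → χ (suc v) u) ⟩
    ∑cells χ + ∑cells (χ ∘ suc) + ∑cells (λ u v → χ v u) + ∑cells (λ u v → χ (suc v) u)
      ≡⟨ cong₂ _+_ (cong₂ _+_ (cong (leftVertices +_) left-shift) right-swap) right-shift ⟩
    leftVertices + leftVertices + rightVertices + rightVertices
      ≡⟨ double leftVertices rightVertices ⟩
    2 * (leftVertices + rightVertices) ∎
    where
      open ≡-Reasoning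
      left-shift : ∑cells (χ ∘ suc) ≡ leftVertices
      left-shift = ∑-shift 1 l (∑-zero s r (λ _ _ → χ-zero ¬V-first-row))
                               (∑-zero s r (λ _ _ → χ-zero ¬V-summit-row))
      right-swap : ∑cells (λ u v → χ v u) ≡ rightVertices
      right-swap = ∑-swap 1 l s r (λ u v → χ v u)
      right-shift : ∑cells (λ u v → χ (suc v) u) ≡ rightVertices
      right-shift = trans (∑-swap 1 l s r (λ u v → χ (suc v) u))
                          (∑-shift s r (∑-zero 1 l (λ _ _ → χ-zero ¬V-summit-row))
                                       (∑-zero 1 l (λ _ _ → χ-zero ¬V-last-row)))
      double : ∀ a b → a + a + b + b ≡ 2 * (a + b)
      double = solve-∀

  vertexCount+1≤ : vertexCount + 1 ≤ l * r
  vertexCount+1≤ = *-cancelˡ-≤ 2 (begin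
    2 * (vertexCount + 1)                       ≡⟨ *-distribˡ-+ 2 vertexCount 1 ⟩
    2 * vertexCount + 2                         ≡⟨ cong (λ c → 2 * c + 2) vertexCount≡left+right ⟩
    2 * (leftVertices + rightVertices) + 2      ≡⟨ cong (_+ 2) ∑cells-incidences ⟨
    ∑cells incidences + 2                       ≤⟨ ∑cells-incidences+2≤ ⟩
    2 * (l * r)                                 ∎)
    where open ≤-Reasoning

no-index-pairs : ∀ {n s} → s ≤ 1 ⊎ n ≤ s → ∀ ij → ¬ IndexOK n s ij
no-index-pairs (inj₁ s≤1) _ (inj₁ (1<i , i<s , _))           = <⇒≱ (<-trans 1<i i<s) s≤1
no-index-pairs (inj₁ s≤1) _ (inj₂ (1≤j , j<s , _))           = <⇒≱ (≤-<-trans 1≤j j<s) s≤1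
no-index-pairs (inj₂ n≤s) _ (inj₁ (_ , _ , s≤j , j<n))       = <⇒≱ (≤-<-trans s≤j j<n) n≤s
no-index-pairs (inj₂ n≤s) _ (inj₂ (_ , _ , s<i , i<n))       = <⇒≱ (<-trans s<i i<n) n≤s

no-vertices-bound : ∀ {n s} p → 3 ≤ n → (∀ ij → ¬ IndexOK n s ij) →
                    4 * rangeGraphVertexCount n p s ≤ (n ∸ 1) ^ 2 + 4
no-vertices-bound {n@(suc (suc (suc k)))} {s} p (s≤s (s≤s (s≤s z≤n))) ¬ok =
  subst (λ xs → 4 * (length xs + 2) ≤ (n ∸ 1) ^ 2 + 4)
        (sym (filter-none (isIntersectionVertex? n p s) {allPairs n} (All.tabulate (λ {ij} _ → ¬ok ij ∘ proj₁))))
        (4[m+2]≤[a+b]^2+4 {0} 1 (suc k) (s≤s z≤n))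

summit-split : ∀ {s n} → 1 < s → s < n → ∃₂ λ l r → s ≡ suc l × n ≡ suc l + r × 1 ≤ l × 1 ≤ r
summit-split {suc l} (s≤s 1≤l) s<n with m≤n⇒∃[o]m+o≡n (<⇒≤ s<n)
... | zero  , refl = contradiction s<n (<-irrefl (sym (+-identityʳ (suc l))))
... | suc r , refl = l , suc r , refl , refl , 1≤l , s≤s z≤n

lemma20 : (n : ℕ) (p : Points) (s : ℕ) → 3 ≤ n → IsRange n p → IsSummit n p s →
          4 * rangeGraphVertexCount n p s ≤ (n ∸ 1) ^ 2 + 4
lemma20 n p s 3≤n R _ with s ≤? 1 | n ≤? s
... | yes s≤1 | _       = no-vertices-bound p 3≤n (no-index-pairs (inj₁ s≤1))
... | no _    | yes n≤s = no-vertices-bound p 3≤n (no-index-pairs (inj₂ n≤s))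
... | no s≰1  | no n≰s  with summit-split (≰⇒> s≰1) (≰⇒> n≰s)
...   | l , r , refl , refl , 1≤l , 1≤r =
  4[m+2]≤[a+b]^2+4 l r (RangeGraphVertices.vertexCount+1≤ p l r 1≤l 1≤r R)
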